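{- Let $V=\mathbb{F}_3^4$ with standard basis $e_1,e_2,e_3,e_4$, and put $e_5=-(e_1+e_2+e_3+e_4)$ and $S=\{0,e_1,e_2,e_3,e_4,e_5\}$. Let $N_0=\langle e_1,e_2,e_3-e_4\rangle\le V$, $N_1=e_3+N_0$, $N_2=e_3+e_4+N_0$. Let $e_1'=-e_1+e_3$, $e_2'=-e_1+e_3-e_4$, $e_3'=-e_2+e_4$, $e_4'=-e_2-e_3+e_4$ and $S'=\{0,e_1',e_2',e_3',e_4',e_5\}$. Define the incidence structures $\mathcal{G}=(V,\mathcal{L})$ with $\mathcal{L}=\{x+S\mid x\in V\}$ and $\mathcal{G}'=(V,\mathcal{L}')$ with \[\mathcal{L}'=\{x+S'\mid x\in N_1\}\cup\{x+S\mid x\in N_0\cup N_2\},\] where in both cases a point $p\in V$ is incident with a line $\ell$ iff $p\in\ell$. Then $\mathcal{G}'$ is a partial geometry $pg(5,5,2)$, and $\mathcal{G}'$ is not isomorphic to $\mathcal{G}$ (the partial geometry $pg(5,5,2)$ of van Lint and Schrijver).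
   Context: A partial geometry $pg(s,t,\alpha)$ is a point–line incidence structure that is a partial linear space (any two distinct points lie on at most one common line) in which every line contains exactly $s+1$ points, every point lies on exactly $t+1$ lines, and for every point $P$ and line $\ell$ not incident with $P$ there are exactly $\alpha$ points on $\ell$ that are collinear with $P$. Two incidence structures $(\mathcal{P}_1,\mathcal{L}_1)$ and $(\mathcal{P}_2,\mathcal{L}_2)$, with lines given as subsets of points, are isomorphic if there is a bijection $\mathcal{P}_1\to\mathcal{P}_2$ inducing a bijection $\mathcal{L}_1\to\mathcal{L}_2$. -}

module Defs where

open import Data.Bool using (Bool; true; false)
open import Data.Fin using (Fin; zero; suc)
import Data.Fin as Fin
open import Data.Vec using (Vec; []; _∷_; zipWith; map)
open import Data.Vec.Properties using (≡-dec)
open import Data.List using (List; length) renaming ([] to []ₗ; _∷_ to _∷ₗ_)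
open import Data.List.Relation.Unary.All using (All)
open import Data.List.Relation.Unary.Any using (Any)
open import Data.List.Relation.Unary.AllPairs using (AllPairs)
open import Data.Nat using (ℕ; suc)
open import Data.Product using (Σ; ∃; ∃-syntax; _×_; _,_)
open import Data.Sum using (_⊎_)
open import Function.Bundles using (_↔_; Inverse)
open import Relation.Nullary using (¬_; does)
open import Relation.Binary.PropositionalEquality using (_≡_; _≢_)

F₃ : Set
F₃ = Fin 3

infixl 6 _+₃_
infixl 7 _*₃_

_+₃_ : F₃ → F₃ → F₃
zero +₃ b = b
suc zero +₃ zero = suc zero
suc zero +₃ suc zero = suc (suc zero)
suc zero +₃ suc (suc zero) = zero
suc (suc zero) +₃ zero = suc (suc zero)
suc (suc zero) +₃ suc zero = zero
suc (suc zero) +₃ suc (suc zero) = suc zero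

-₃_ : F₃ → F₃
-₃ zero = zero
-₃ suc zero = suc (suc zero)
-₃ suc (suc zero) = suc zero

_*₃_ : F₃ → F₃ → F₃
zero *₃ b = zero
suc zero *₃ b = b
suc (suc zero) *₃ b = -₃ b

V : Set
V = Vec F₃ 4

infixl 6 _⊕_ _⊖_
infixl 7 _·_

_⊕_ : V → V → V
_⊕_ = zipWith _+₃_

⊝_ : V → V
⊝ v = map -₃_ v

_⊖_ : V → V → V
u ⊖ v = u ⊕ (⊝ v)

_·_ : F₃ → V → V
a · v = map (a *₃_) v

_≟V_ : (u v : V) → Relation.Nullary.Dec (u ≡ v)
_≟V_ = ≡-dec Fin._≟_

o₃ i₃ : F₃
o₃ = zero
i₃ = suc zero

𝟎 e₁ e₂ e₃ e₄ e₅ : V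
𝟎  = o₃ ∷ o₃ ∷ o₃ ∷ o₃ ∷ []
e₁ = i₃ ∷ o₃ ∷ o₃ ∷ o₃ ∷ []
e₂ = o₃ ∷ i₃ ∷ o₃ ∷ o₃ ∷ []
e₃ = o₃ ∷ o₃ ∷ i₃ ∷ o₃ ∷ []
e₄ = o₃ ∷ o₃ ∷ o₃ ∷ i₃ ∷ []
e₅ = ⊝ (e₁ ⊕ e₂ ⊕ e₃ ⊕ e₄)

e₁' e₂' e₃' e₄' : V
e₁' = (⊝ e₁) ⊕ e₃
e₂' = (⊝ e₁) ⊕ e₃ ⊖ e₄
e₃' = (⊝ e₂) ⊕ e₄
e₄' = (⊝ e₂) ⊖ e₃ ⊕ e₄

S S' : List V
S  = 𝟎 ∷ₗ e₁  ∷ₗ e₂  ∷ₗ e₃  ∷ₗ e₄  ∷ₗ e₅ ∷ₗ []ₗ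
S' = 𝟎 ∷ₗ e₁' ∷ₗ e₂' ∷ₗ e₃' ∷ₗ e₄' ∷ₗ e₅ ∷ₗ []ₗ

Subset : Set
Subset = V → Bool

_≈ₛ_ : Subset → Subset → Set
A ≈ₛ B = ∀ p → A p ≡ B p

_∈ₛ_ : V → Subset → Set
p ∈ₛ A = A p ≡ true

infix 5 _+ₛ_
_+ₛ_ : V → List V → Subset
(x +ₛ []ₗ) p = false
(x +ₛ (s ∷ₗ T)) p with does (p ≟V (x ⊕ s))
... | true  = true
... | false = (x +ₛ T) p

InN₀ InN₁ InN₂ : V → Set
InN₀ x = ∃[ a ] ∃[ b ] ∃[ c ] (x ≡ a · e₁ ⊕ b · e₂ ⊕ c · (e₃ ⊖ e₄))
InN₁ x = ∃[ n ] (InN₀ n × x ≡ e₃ ⊕ n)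
InN₂ x = ∃[ n ] (InN₀ n × x ≡ e₃ ⊕ e₄ ⊕ n)

LineSet : Set₁
LineSet = Subset → Set

𝓛 : LineSet
𝓛 ℓ = ∃[ x ] (ℓ ≈ₛ (x +ₛ S))

𝓛' : LineSet
𝓛' ℓ = (∃[ x ] (InN₁ x × ℓ ≈ₛ (x +ₛ S')))
     ⊎ (∃[ x ] ((InN₀ x ⊎ InN₂ x) × ℓ ≈ₛ (x +ₛ S)))

HasExactly : ℕ → (A : Set₀) → (A → A → Set) → (A → Set) → Set
HasExactly k A _≈_ P =
  Σ (List A) λ xs →
    length xs ≡ k × All P xs × AllPairs (λ a b → ¬ (a ≈ b)) xs
    × (∀ a → P a → Any (λ b → a ≈ b) xs)

Collinear : LineSet → V → V → Set
Collinear L p q = ∃[ m ] (L m × p ∈ₛ m × q ∈ₛ m)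

record IsPartialGeometry (s t α : ℕ) (L : LineSet) : Set₁ where
  field
    partialLinear : ∀ p q → p ≢ q → ∀ ℓ m → L ℓ → L m →
                    p ∈ₛ ℓ → q ∈ₛ ℓ → p ∈ₛ m → q ∈ₛ m → ℓ ≈ₛ m
    linePoints    : ∀ ℓ → L ℓ → HasExactly (suc s) V _≡_ (λ p → p ∈ₛ ℓ)
    pointLines    : ∀ p → HasExactly (suc t) Subset _≈ₛ_ (λ ℓ → L ℓ × p ∈ₛ ℓ)
    alphaAxiom    : ∀ p ℓ → L ℓ → ℓ p ≡ false →
                    HasExactly α V _≡_ (λ q → q ∈ₛ ℓ × Collinear L p q)

image : V ↔ V → Subset → Subset
image f ℓ p = ℓ (Inverse.from f p)

Isomorphic : LineSet → LineSet → Set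
Isomorphic L₁ L₂ = Σ (V ↔ V) λ f →
  (∀ ℓ → L₁ ℓ → L₂ (image f ℓ)) ×
  (∀ m → L₂ m → ∃[ ℓ ] (L₁ ℓ × image f ℓ ≈ₛ m))

-- 𝓛' consists of the translates x + shapeOf (φ x), where φ(x) = x₃ + x₄ has kernel N₀ and fibres
-- N₁, N₂, and shapeOf picks S' on φ = 1 and S elsewhere; 𝓛 consists of the translates x + S.
-- For such translation structures every incidence question is finite, and the partial geometry
-- axioms of 𝓛' reduce to a handful of counts that are checked exhaustively over the 81 points.
--
-- Non-isomorphism is detected by free 5-cliques: five pairwise collinear points, no three on a line.
-- 𝓛 has one through 𝟎, hence through every point because translations are automorphisms of 𝓛.  In 𝓛'
-- none passes through 𝟎: a search that extends cliques from 𝟎, keeping only the candidates collinear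
-- with every chosen point and off every line joining two of them, ends with nothing.
module Submission where

open import Defs
open import Data.Bool as Bool using (true; false)
open import Data.Bool.Properties using (⇔→≡)
open import Data.Unit using (⊤; tt)
import Data.Fin as Fin
import Data.Fin.Properties as Fin
open import Data.List
  using (List; []; _∷_; _++_; _ʳ++_; [_]; reverse; map; filter; length; concatMap; cartesianProductWith; allFin)
open import Data.List.Membership.Propositional using (_∈_; find; lose)
open import Data.List.Membership.Propositional.Properties
  using (∈-filter⁺; ∈-filter⁻; ∈-concatMap⁺; ∈-concatMap⁻; ∈-cartesianProductWith⁺; ∈-allFin)
open import Data.List.Membership.DecPropositional _≟V_ using (_∈?_)
open import Data.List.Properties
  using (length-map; map-++; filter-all; ʳ++-defn; reverse-involutive; length-reverse)
open import Data.List.Relation.Unary.All as All using (All; []; _∷_)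
import Data.List.Relation.Unary.All.Properties as All
open import Data.List.Relation.Unary.Any as Any using (Any; here; there; any?)
import Data.List.Relation.Unary.Any.Properties as Any
open import Data.List.Relation.Unary.AllPairs as AllPairs using (AllPairs; []; _∷_)
import Data.List.Relation.Unary.AllPairs.Properties as AllPairs
open import Data.List.Relation.Unary.Unique.Propositional using (Unique)
import Data.List.Relation.Unary.Unique.Propositional.Properties as Unique
open import Data.Nat using (ℕ; zero; suc; _≤_; s≤s)
import Data.Nat as ℕ
open import Data.Product using (∃-syntax; _×_; _,_; proj₁; proj₂)
import Data.Product as Product
open import Data.Sum using (_⊎_; inj₁; inj₂)
open import Data.Vec using (Vec; []; _∷_)
import Data.Vec as Vec
import Data.Vec.Properties as Vec
open import Function using (_∘_; case_of_)
open import Function.Bundles using (_↔_; _⇔_; mk⇔; mk↔ₛ′; Inverse; Equivalence)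
open import Function.Construct.Identity using (↔-id; ⇔-id)
open import Function.Properties.Equivalence using () renaming (sym to ⇔-sym)
open import Data.Product.Function.NonDependent.Propositional using (_×-⇔_)
open import Relation.Nullary using (¬_; Dec; yes; no; _×-dec_; _⊎-dec_; _→-dec_; ¬?; contradiction)
open import Relation.Nullary.Decidable using (from-yes; map′)
open import Relation.Binary.PropositionalEquality
  using (_≡_; _≢_; refl; sym; trans; cong; subst; module ≡-Reasoning)

+₃-identityʳ : ∀ a → a +₃ o₃ ≡ a
+₃-identityʳ = from-yes (Fin.all? λ a → a +₃ o₃ Fin.≟ a)

+₃-cancelˡ : ∀ a b c → a +₃ b ≡ a +₃ c → b ≡ c
+₃-cancelˡ = from-yes (Fin.all? λ a → Fin.all? λ b → Fin.all? λ c → (a +₃ b Fin.≟ a +₃ c) →-dec (b Fin.≟ c))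

+₃-cancelʳ : ∀ a b → a +₃ b +₃ -₃ b ≡ a
+₃-cancelʳ = from-yes (Fin.all? λ a → Fin.all? λ b → a +₃ b +₃ -₃ b Fin.≟ a)

-₃-cancelʳ : ∀ a b → a +₃ -₃ b +₃ b ≡ a
-₃-cancelʳ = from-yes (Fin.all? λ a → Fin.all? λ b → a +₃ -₃ b +₃ b Fin.≟ a)

+₃-rightComm : ∀ a b c → a +₃ b +₃ c ≡ a +₃ c +₃ b
+₃-rightComm = from-yes (Fin.all? λ a → Fin.all? λ b → Fin.all? λ c → a +₃ b +₃ c Fin.≟ a +₃ c +₃ b)

+₃-interchange : ∀ a b c d → a +₃ b +₃ (c +₃ d) ≡ a +₃ c +₃ (b +₃ d)
+₃-interchange = from-yes (Fin.all? λ a → Fin.all? λ b → Fin.all? λ c → Fin.all? λ d →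
                   a +₃ b +₃ (c +₃ d) Fin.≟ a +₃ c +₃ (b +₃ d))

⊕-identityˡ : ∀ v → 𝟎 ⊕ v ≡ v
⊕-identityˡ (a ∷ b ∷ c ∷ d ∷ []) = refl

⊕-cancelˡ : ∀ x {u v} → x ⊕ u ≡ x ⊕ v → u ≡ v
⊕-cancelˡ (a ∷ b ∷ c ∷ d ∷ []) {a' ∷ b' ∷ c' ∷ d' ∷ []} {a″ ∷ b″ ∷ c″ ∷ d″ ∷ []} eq
  with refl ← +₃-cancelˡ a a' a″ (cong Vec.head eq)
     | refl ← +₃-cancelˡ b b' b″ (cong (Vec.head ∘ Vec.tail) eq)
     | refl ← +₃-cancelˡ c c' c″ (cong (Vec.head ∘ Vec.tail ∘ Vec.tail) eq)
     | refl ← +₃-cancelˡ d d' d″ (cong (Vec.head ∘ Vec.tail ∘ Vec.tail ∘ Vec.tail) eq) = refl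

⊕-⊖-cancelʳ : ∀ x v → x ⊕ v ⊖ v ≡ x
⊕-⊖-cancelʳ (a ∷ b ∷ c ∷ d ∷ []) (a' ∷ b' ∷ c' ∷ d' ∷ [])
  rewrite +₃-cancelʳ a a' | +₃-cancelʳ b b' | +₃-cancelʳ c c' | +₃-cancelʳ d d' = refl

⊖-⊕-cancelʳ : ∀ x v → x ⊖ v ⊕ v ≡ x
⊖-⊕-cancelʳ (a ∷ b ∷ c ∷ d ∷ []) (a' ∷ b' ∷ c' ∷ d' ∷ [])
  rewrite -₃-cancelʳ a a' | -₃-cancelʳ b b' | -₃-cancelʳ c c' | -₃-cancelʳ d d' = refl

⊕-rightComm : ∀ x u v → x ⊕ u ⊕ v ≡ x ⊕ v ⊕ u
⊕-rightComm (a ∷ b ∷ c ∷ d ∷ []) (a' ∷ b' ∷ c' ∷ d' ∷ []) (a″ ∷ b″ ∷ c″ ∷ d″ ∷ [])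
  rewrite +₃-rightComm a a' a″ | +₃-rightComm b b' b″ | +₃-rightComm c c' c″ | +₃-rightComm d d' d″ = refl

φ : V → F₃
φ (_ ∷ _ ∷ c ∷ d ∷ []) = c +₃ d

φ-⊕ : ∀ u v → φ (u ⊕ v) ≡ φ u +₃ φ v
φ-⊕ (_ ∷ _ ∷ c ∷ d ∷ []) (_ ∷ _ ∷ c' ∷ d' ∷ []) = +₃-interchange c c' d d'

spanN₀ : F₃ → F₃ → F₃ → V
spanN₀ a b c = a · e₁ ⊕ b · e₂ ⊕ c · (e₃ ⊖ e₄)

φ-spanN₀ : ∀ a b c → φ (spanN₀ a b c) ≡ o₃
φ-spanN₀ = from-yes (Fin.all? λ a → Fin.all? λ b → Fin.all? λ c → φ (spanN₀ a b c) Fin.≟ o₃)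

φ-N₀ : ∀ {x} → InN₀ x → φ x ≡ o₃
φ-N₀ (a , b , c , refl) = φ-spanN₀ a b c

φ-coset : ∀ v {x} → ∃[ n ] (InN₀ n × x ≡ v ⊕ n) → φ x ≡ φ v
φ-coset v (n , n∈N₀ , refl) = trans (φ-⊕ v n) (trans (cong (φ v +₃_) (φ-N₀ n∈N₀)) (+₃-identityʳ (φ v)))

InN₀? : ∀ x → Dec (InN₀ x)
InN₀? x = Fin.any? λ a → Fin.any? λ b → Fin.any? λ c → x ≟V spanN₀ a b c

coset? : ∀ v x → Dec (∃[ n ] (InN₀ n × x ≡ v ⊕ n))
coset? v x = map′ (λ (a , b , c , x≡) → spanN₀ a b c , (a , b , c , refl) , x≡)
                  (λ { (_ , (a , b , c , refl) , x≡) → a , b , c , x≡ })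
                  (Fin.any? λ a → Fin.any? λ b → Fin.any? λ c → x ≟V (v ⊕ spanN₀ a b c))

vectors : ∀ n → List (Vec F₃ n)
vectors zero = [ [] ]
vectors (suc n) = cartesianProductWith _∷_ (allFin 3) (vectors n)

∈-vectors : ∀ {n} (v : Vec F₃ n) → v ∈ vectors n
∈-vectors [] = here refl
∈-vectors (a ∷ v) = ∈-cartesianProductWith⁺ _∷_ (∈-allFin a) (∈-vectors v)

vectors-unique : ∀ n → Unique (vectors n)
vectors-unique zero = [] ∷ []
vectors-unique (suc n) = Unique.cartesianProductWith⁺ _∷_ Vec.∷-injective (Unique.allFin⁺ 3) (vectors-unique n)

allV : List V
allV = vectors 4

∀V? : {P : V → Set} → (∀ v → Dec (P v)) → Dec (∀ v → P v)
∀V? P? = map′ (λ all v → All.lookup all (∈-vectors v)) (λ ∀P → All.tabulate λ {v} _ → ∀P v) (All.all? P? allV)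

N-cover : ∀ x → InN₀ x ⊎ InN₁ x ⊎ InN₂ x
N-cover = from-yes (∀V? λ x → InN₀? x ⊎-dec coset? e₃ x ⊎-dec coset? (e₃ ⊕ e₄) x)

∈-translate : ∀ {x T p} → p ∈ₛ (x +ₛ T) ⇔ p ∈ map (x ⊕_) T
∈-translate {x} {T} {p} = mk⇔ (Any.map⁺ ∘ to T) (from T ∘ Any.map⁻)
  where
  to : ∀ T → p ∈ₛ (x +ₛ T) → Any (λ s → p ≡ x ⊕ s) T
  to (s ∷ T) p∈ with p ≟V (x ⊕ s)
  ... | yes p≡ = here p≡
  ... | no _ = there (to T p∈)
  from : ∀ T → Any (λ s → p ≡ x ⊕ s) T → p ∈ₛ (x +ₛ T)
  from (s ∷ T) p∈ with p ≟V (x ⊕ s) | p∈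
  ... | yes _ | _ = refl
  ... | no p≢ | here p≡ = contradiction p≡ p≢
  ... | no _ | there p∈T = from T p∈T

+ₛ-translate : ∀ x v T p → (x +ₛ T) (p ⊖ v) ≡ ((x ⊕ v) +ₛ T) p
+ₛ-translate x v T p = ⇔→≡ (mk⇔
  (Equivalence.from ∈-translate ∘ Any.map⁺ ∘ Any.map to ∘
   Any.map⁻ {f = x ⊕_} ∘ Equivalence.to (∈-translate {x} {T}))
  (Equivalence.from (∈-translate {x} {T}) ∘ Any.map⁺ ∘ Any.map from ∘
   Any.map⁻ {f = x ⊕ v ⊕_} ∘ Equivalence.to ∈-translate))
  where
  open ≡-Reasoning
  to : ∀ {s} → p ⊖ v ≡ x ⊕ s → p ≡ x ⊕ v ⊕ s
  to {s} e = begin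
    p              ≡⟨ sym (⊖-⊕-cancelʳ p v) ⟩
    p ⊖ v ⊕ v      ≡⟨ cong (_⊕ v) e ⟩
    x ⊕ s ⊕ v      ≡⟨ ⊕-rightComm x s v ⟩
    x ⊕ v ⊕ s      ∎
  from : ∀ {s} → p ≡ x ⊕ v ⊕ s → p ⊖ v ≡ x ⊕ s
  from {s} e = begin
    p ⊖ v          ≡⟨ cong (_⊖ v) (trans e (⊕-rightComm x v s)) ⟩
    x ⊕ s ⊕ v ⊖ v  ≡⟨ ⊕-⊖-cancelʳ (x ⊕ s) v ⟩
    x ⊕ s          ∎

reverse-ʳ++ : ∀ {A : Set} (xs ys : List A) → reverse xs ʳ++ ys ≡ xs ++ ys
reverse-ʳ++ xs ys = trans (ʳ++-defn (reverse xs)) (cong (_++ ys) (reverse-involutive xs))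

≈ₛ-sym : ∀ {A B} → A ≈ₛ B → B ≈ₛ A
≈ₛ-sym A≈B p = sym (A≈B p)

∈ₛ-resp : ∀ {A B p} → A ≈ₛ B → p ∈ₛ A → p ∈ₛ B
∈ₛ-resp {p = p} A≈B p∈A = trans (sym (A≈B p)) p∈A

≤1-∈-equal : ∀ {A : Set} {xs : List A} {a b} → length xs ≤ 1 → a ∈ xs → b ∈ xs → a ≡ b
≤1-∈-equal {xs = _ ∷ []} _ (here refl) (here refl) = refl
≤1-∈-equal {xs = _ ∷ _ ∷ _} (s≤s ()) _ _

HasExactly-fromList : ∀ {k} {P : V → Set} (xs : List V) → length xs ≡ k → Unique xs →
                      (∀ a → P a ⇔ a ∈ xs) → HasExactly k V _≡_ P
HasExactly-fromList xs refl xs! P⇔∈ =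
  xs , refl , All.tabulate (λ {a} → Equivalence.from (P⇔∈ a)) , xs! , λ a → Equivalence.to (P⇔∈ a)

HasExactly-resp : ∀ {k A _≈_} {P Q : A → Set} → (∀ a → P a ⇔ Q a) →
                  HasExactly k A _≈_ P → HasExactly k A _≈_ Q
HasExactly-resp P⇔Q (xs , len , all , distinct , complete) =
  xs , len , All.map (λ {a} → Equivalence.to (P⇔Q a)) all , distinct , λ a → complete a ∘ Equivalence.from (P⇔Q a)

Collinear-sym : ∀ {L p q} → Collinear L p q → Collinear L q p
Collinear-sym (m , Lm , p∈ , q∈) = m , Lm , q∈ , p∈

Collinear-resp : ∀ {L₁ L₂ : LineSet} → (∀ ℓ → L₁ ℓ ⇔ L₂ ℓ) →
                 ∀ {p q} → Collinear L₁ p q ⇔ Collinear L₂ p q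
Collinear-resp L₁⇔L₂ = mk⇔ (Product.map₂ (Product.map₁ (Equivalence.to (L₁⇔L₂ _))))
                           (Product.map₂ (Product.map₁ (Equivalence.from (L₁⇔L₂ _))))

IsPartialGeometry-resp : ∀ {s t α} {L₁ L₂ : LineSet} → (∀ ℓ → L₁ ℓ ⇔ L₂ ℓ) →
                         IsPartialGeometry s t α L₁ → IsPartialGeometry s t α L₂
IsPartialGeometry-resp {L₁ = L₁} {L₂} L₁⇔L₂ pg = record
  { partialLinear = λ p q p≢q ℓ m L₂ℓ L₂m → partialLinear p q p≢q ℓ m (from L₂ℓ) (from L₂m)
  ; linePoints = λ ℓ → linePoints ℓ ∘ from
  ; pointLines = λ p → HasExactly-resp (λ ℓ → L₁⇔L₂ ℓ ×-⇔ ⇔-id _) (pointLines p)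
  ; alphaAxiom = λ p ℓ L₂ℓ →
      HasExactly-resp (λ q → ⇔-id _ ×-⇔ Collinear-resp L₁⇔L₂) ∘ alphaAxiom p ℓ (from L₂ℓ)
  }
  where
  open IsPartialGeometry pg
  from : ∀ {ℓ} → L₂ ℓ → L₁ ℓ
  from = Equivalence.from (L₁⇔L₂ _)

-- Free cliques

Collinear₃ : LineSet → V → V → V → Set
Collinear₃ L p q r = ∃[ m ] (L m × p ∈ₛ m × q ∈ₛ m × r ∈ₛ m)

Collinear₃-swap : ∀ {L p q r} → Collinear₃ L p q r → Collinear₃ L q p r
Collinear₃-swap (m , Lm , p∈ , q∈ , r∈) = m , Lm , q∈ , p∈ , r∈

Extends : LineSet → V → List V → Set
Extends L q qs = All (λ r → q ≢ r × Collinear L q r) qs × AllPairs (λ r r' → ¬ Collinear₃ L q r r') qs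

IsFreeClique : LineSet → List V → Set
IsFreeClique L [] = ⊤
IsFreeClique L (q ∷ qs) = Extends L q qs × IsFreeClique L qs

CliqueThrough : ℕ → LineSet → V → Set
CliqueThrough k L p = ∃[ qs ] (length qs ≡ k × IsFreeClique L (qs ++ [ p ]))

Extends-tail : ∀ {L c q qs} → Extends L c (q ∷ qs) → Extends L c qs
Extends-tail (_ ∷ distinct , _ ∷ noLine) = distinct , noLine

IsFreeClique-suffix : ∀ {L} ps {qs} → IsFreeClique L (ps ʳ++ qs) → IsFreeClique L qs
IsFreeClique-suffix [] clique = clique
IsFreeClique-suffix (_ ∷ ps) clique = proj₂ (IsFreeClique-suffix ps clique)

module _ {L₁ L₂ : LineSet} (iso : Isomorphic L₁ L₂) where
  private
    f : V ↔ V
    f = proj₁ iso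
    lines⁺ : ∀ ℓ → L₁ ℓ → L₂ (image f ℓ)
    lines⁺ = proj₁ (proj₂ iso)
    lines⁻ : ∀ m → L₂ m → ∃[ ℓ ] (L₁ ℓ × image f ℓ ≈ₛ m)
    lines⁻ = proj₂ (proj₂ iso)
  open Inverse f using (to; from; strictlyInverseˡ; strictlyInverseʳ)

  ∈-image : ∀ {ℓ p} → p ∈ₛ ℓ → to p ∈ₛ image f ℓ
  ∈-image {ℓ} {p} = subst (λ z → z ∈ₛ ℓ) (sym (strictlyInverseʳ p))

  Collinear-image : ∀ {p q} → Collinear L₁ p q → Collinear L₂ (to p) (to q)
  Collinear-image (ℓ , L₁ℓ , p∈ , q∈) = image f ℓ , lines⁺ ℓ L₁ℓ , ∈-image {ℓ} p∈ , ∈-image {ℓ} q∈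

  Collinear₃-preimage : ∀ {p q r} → Collinear₃ L₂ (to p) (to q) (to r) → Collinear₃ L₁ p q r
  Collinear₃-preimage (m , L₂m , p∈ , q∈ , r∈) with lines⁻ m L₂m
  ... | ℓ , L₁ℓ , ℓ≈m = ℓ , L₁ℓ , preimage p∈ , preimage q∈ , preimage r∈
    where
    preimage : ∀ {p} → to p ∈ₛ m → p ∈ₛ ℓ
    preimage {p} p∈m = subst (λ z → z ∈ₛ ℓ) (strictlyInverseʳ p) (∈ₛ-resp (≈ₛ-sym ℓ≈m) p∈m)

  to-injective : ∀ {p q} → to p ≡ to q → p ≡ q
  to-injective {p} {q} e = trans (sym (strictlyInverseʳ p)) (trans (cong from e) (strictlyInverseʳ q))

  IsFreeClique-image : ∀ {qs} → IsFreeClique L₁ qs → IsFreeClique L₂ (map to qs)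
  IsFreeClique-image {[]} tt = tt
  IsFreeClique-image {q ∷ qs} ((distinct , noLine) , clique) =
    (All.map⁺ (All.map (Product.map (_∘ to-injective) Collinear-image) distinct) ,
     AllPairs.map⁺ (AllPairs.map (_∘ Collinear₃-preimage) noLine)) ,
    IsFreeClique-image clique

  CliqueThrough-image : ∀ {k p} → CliqueThrough k L₁ p → CliqueThrough k L₂ (to p)
  CliqueThrough-image {p = p} (qs , len , clique) =
    map to qs , trans (length-map to qs) len ,
    subst (IsFreeClique L₂) (map-++ to qs [ p ]) (IsFreeClique-image clique)

  CliqueThrough-everywhere : ∀ {k} → (∀ p → CliqueThrough k L₁ p) → ∀ q → CliqueThrough k L₂ q
  CliqueThrough-everywhere cliques q =
    subst (CliqueThrough _ L₂) (strictlyInverseˡ q) (CliqueThrough-image (cliques (from q)))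

Isomorphic-⇔ : ∀ {L₁ L₂ : LineSet} → (∀ ℓ → L₁ ℓ ⇔ L₂ ℓ) → Isomorphic L₁ L₂
Isomorphic-⇔ L₁⇔L₂ =
  ↔-id _ , (λ ℓ → Equivalence.to (L₁⇔L₂ ℓ)) , λ m L₂m → m , Equivalence.from (L₁⇔L₂ m) L₂m , λ _ → refl

-- Translation geometries

module TranslationGeometry (shape : V → List V) where

  line : V → Subset
  line x = x +ₛ shape x

  Lines : LineSet
  Lines ℓ = ∃[ x ] (ℓ ≈ₛ line x)

  pointsOn : V → List V
  pointsOn x = map (x ⊕_) (shape x)

  ∈-pointsOn : ∀ {p x} → p ∈ₛ line x ⇔ p ∈ pointsOn x
  ∈-pointsOn = ∈-translate

  _∈ₗ?_ : ∀ p x → Dec (p ∈ₛ line x)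
  p ∈ₗ? x = line x p Bool.≟ true

  linesThrough : V → List V
  linesThrough p = filter (p ∈ₗ?_) allV

  ∈-linesThrough : ∀ {p x} → x ∈ linesThrough p ⇔ p ∈ₛ line x
  ∈-linesThrough {p} = mk⇔ (proj₂ ∘ ∈-filter⁻ (p ∈ₗ?_) {xs = allV}) (∈-filter⁺ (p ∈ₗ?_) (∈-vectors _))

  neighbours : V → List V
  neighbours p = concatMap pointsOn (linesThrough p)

  ∈-neighbours : ∀ {p q} → q ∈ neighbours p ⇔ Collinear Lines p q
  ∈-neighbours {p} {q} = mk⇔ to from
    where
    to : q ∈ neighbours p → Collinear Lines p q
    to q∈ with find (∈-concatMap⁻ pointsOn {xs = linesThrough p} q∈)
    ... | x , x∈ , q∈x =
      line x , (x , λ _ → refl) , Equivalence.to ∈-linesThrough x∈ , Equivalence.from ∈-pointsOn q∈x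
    from : Collinear Lines p q → q ∈ neighbours p
    from (m , (x , m≈) , p∈m , q∈m) =
      ∈-concatMap⁺ pointsOn (lose (Equivalence.from ∈-linesThrough (∈ₛ-resp m≈ p∈m))
                                  (Equivalence.to ∈-pointsOn (∈ₛ-resp m≈ q∈m)))

  Any-linesThrough⇔Collinear₃ : ∀ {p q r} →
    Any (λ x → q ∈ₛ line x × r ∈ₛ line x) (linesThrough p) ⇔ Collinear₃ Lines p q r
  Any-linesThrough⇔Collinear₃ {p} {q} {r} = mk⇔ to from
    where
    to : Any (λ x → q ∈ₛ line x × r ∈ₛ line x) (linesThrough p) → Collinear₃ Lines p q r
    to h with find h
    ... | x , x∈ , q∈ , r∈ = line x , (x , λ _ → refl) , Equivalence.to ∈-linesThrough x∈ , q∈ , r∈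
    from : Collinear₃ Lines p q r → Any (λ x → q ∈ₛ line x × r ∈ₛ line x) (linesThrough p)
    from (m , (x , m≈) , p∈ , q∈ , r∈) =
      lose (Equivalence.from ∈-linesThrough (∈ₛ-resp m≈ p∈)) (∈ₛ-resp m≈ q∈ , ∈ₛ-resp m≈ r∈)

  record IncidenceCounts (s t α : ℕ) : Set where
    field
      shape-length : ∀ x → length (shape x) ≡ suc (suc s)
      shape-unique : ∀ x → Unique (shape x)
      linesThrough-length : ∀ p → length (linesThrough p) ≡ suc t
      meet-atMostOne : ∀ x y → x ≢ y → length (filter (_∈ₗ? y) (pointsOn x)) ≤ 1
      alpha-count : ∀ p x → line x p ≡ false → length (filter (_∈? neighbours p) (pointsOn x)) ≡ α

  -- The neighbourhood N is an argument so that an exhaustive check over all p computes it once per p.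
  alpha-count-at? : ∀ α (N : List V) p →
                    Dec (∀ x → line x p ≡ false → length (filter (_∈? N) (pointsOn x)) ≡ α)
  alpha-count-at? α N p =
    ∀V? λ x → (line x p Bool.≟ false) →-dec (length (filter (_∈? N) (pointsOn x)) ℕ.≟ α)

  module _ {s t α} (counts : IncidenceCounts s t α) where
    open IncidenceCounts counts

    meet-unique : ∀ {x y p q} → x ≢ y → p ∈ₛ line x → q ∈ₛ line x → p ∈ₛ line y → q ∈ₛ line y → p ≡ q
    meet-unique {x} {y} x≢y px qx py qy = ≤1-∈-equal (meet-atMostOne x y x≢y)
      (∈-filter⁺ (_∈ₗ? y) (Equivalence.to ∈-pointsOn px) py)
      (∈-filter⁺ (_∈ₗ? y) (Equivalence.to ∈-pointsOn qx) qy)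

    pointsOn-unique : ∀ x → Unique (pointsOn x)
    pointsOn-unique x = Unique.map⁺ (⊕-cancelˡ x) (shape-unique x)

    pointsOn-length : ∀ x → length (pointsOn x) ≡ suc (suc s)
    pointsOn-length x = trans (length-map (x ⊕_) (shape x)) (shape-length x)

    line-injective : ∀ {x y} → line x ≈ₛ line y → x ≡ y
    line-injective {x} {y} x≈y with x ≟V y
    ... | yes x≡y = x≡y
    ... | no x≢y =
      contradiction (meet-atMostOne x y x≢y) (subst (λ n → ¬ n ≤ 1) (sym meet≡line) λ { (s≤s ()) })
      where
      meet≡line : length (filter (_∈ₗ? y) (pointsOn x)) ≡ suc (suc s)
      meet≡line = trans (cong length (filter-all (_∈ₗ? y) (All.tabulate λ {p} p∈ →
                    trans (sym (x≈y p)) (Equivalence.from ∈-pointsOn p∈)))) (pointsOn-length x)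

    isPartialGeometry : IsPartialGeometry (suc s) t α Lines
    isPartialGeometry = record
      { partialLinear = partialLinear
      ; linePoints = λ ℓ (x , ℓ≈) → HasExactly-fromList (pointsOn x) (pointsOn-length x) (pointsOn-unique x)
          λ a → mk⇔ (Equivalence.to ∈-pointsOn ∘ ∈ₛ-resp ℓ≈) (∈ₛ-resp (≈ₛ-sym ℓ≈) ∘ Equivalence.from ∈-pointsOn)
      ; pointLines = pointLines
      ; alphaAxiom = alphaAxiom
      }
      where
      partialLinear : ∀ p q → p ≢ q → ∀ ℓ m → Lines ℓ → Lines m →
                      p ∈ₛ ℓ → q ∈ₛ ℓ → p ∈ₛ m → q ∈ₛ m → ℓ ≈ₛ m
      partialLinear p q p≢q ℓ m (x , ℓ≈) (y , m≈) pℓ qℓ pm qm with x ≟V y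
      ... | yes refl = λ r → trans (ℓ≈ r) (sym (m≈ r))
      ... | no x≢y = contradiction
        (meet-unique x≢y (∈ₛ-resp ℓ≈ pℓ) (∈ₛ-resp ℓ≈ qℓ) (∈ₛ-resp m≈ pm) (∈ₛ-resp m≈ qm)) p≢q

      pointLines : ∀ p → HasExactly (suc t) Subset _≈ₛ_ (λ ℓ → Lines ℓ × p ∈ₛ ℓ)
      pointLines p =
        map line (linesThrough p) ,
        trans (length-map line (linesThrough p)) (linesThrough-length p) ,
        All.map⁺ (All.tabulate λ x∈ → (_ , λ _ → refl) , Equivalence.to ∈-linesThrough x∈) ,
        AllPairs.map⁺ (AllPairs.map (λ x≢y → x≢y ∘ line-injective) (Unique.filter⁺ (p ∈ₗ?_) (vectors-unique 4))) ,
        λ { ℓ ((x , ℓ≈) , pℓ) → Any.map⁺ (lose (Equivalence.from ∈-linesThrough (∈ₛ-resp ℓ≈ pℓ)) ℓ≈) }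

      alphaAxiom : ∀ p ℓ → Lines ℓ → ℓ p ≡ false →
                   HasExactly α V _≡_ (λ q → q ∈ₛ ℓ × Collinear Lines p q)
      alphaAxiom p ℓ (x , ℓ≈) p∉ℓ =
        HasExactly-fromList (filter (_∈? neighbours p) (pointsOn x)) (alpha-count p x (trans (sym (ℓ≈ p)) p∉ℓ))
          (Unique.filter⁺ (_∈? neighbours p) (pointsOn-unique x)) λ q → mk⇔ to from
        where
        to : ∀ {q} → q ∈ₛ ℓ × Collinear Lines p q → q ∈ filter (_∈? neighbours p) (pointsOn x)
        to (qℓ , pq) = ∈-filter⁺ (_∈? neighbours p) (Equivalence.to ∈-pointsOn (∈ₛ-resp ℓ≈ qℓ))
                                 (Equivalence.from ∈-neighbours pq)
        from : ∀ {q} → q ∈ filter (_∈? neighbours p) (pointsOn x) → q ∈ₛ ℓ × Collinear Lines p q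
        from q∈ with ∈-filter⁻ (_∈? neighbours p) {xs = pointsOn x} q∈
        ... | q∈x , q∈N = ∈ₛ-resp (≈ₛ-sym ℓ≈) (Equivalence.from ∈-pointsOn q∈x) , Equivalence.to ∈-neighbours q∈N

  collinear? : ∀ p q → Dec (Collinear Lines p q)
  collinear? p q = map′ (Equivalence.to ∈-neighbours) (Equivalence.from ∈-neighbours) (q ∈? neighbours p)

  collinear₃? : ∀ p q r → Dec (Collinear₃ Lines p q r)
  collinear₃? p q r =
    map′ (Equivalence.to Any-linesThrough⇔Collinear₃) (Equivalence.from Any-linesThrough⇔Collinear₃)
         (any? (λ x → (q ∈ₗ? x) ×-dec (r ∈ₗ? x)) (linesThrough p))

  isFreeClique? : ∀ qs → Dec (IsFreeClique Lines qs)
  isFreeClique? [] = yes tt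
  isFreeClique? (q ∷ qs) =
    (All.all? (λ r → ¬? (q ≟V r) ×-dec collinear? q r) qs ×-dec
     AllPairs.allPairs? (λ r r' → ¬? (collinear₃? q r r')) qs) ×-dec
    isFreeClique? qs

  -- neighbours q and linesThrough q are arguments of refineWith so that they are computed once per
  -- call of refine, not once per candidate.
  refine : V → List V → List V → List V
  refine q qs = refineWith (neighbours q) (linesThrough q)
    where
    refineWith : List V → List V → List V → List V
    refineWith N T = filter λ c → ¬? (c ≟V q) ×-dec c ∈? N ×-dec
                                   All.all? (λ r → ¬? (any? (λ x → (c ∈ₗ? x) ×-dec (r ∈ₗ? x)) T)) qs

  ∈-refine : ∀ {c q qs C} → Extends Lines c (q ∷ qs) → c ∈ C → c ∈ refine q qs C
  ∈-refine ((c≢q , cq) ∷ _ , noLine ∷ _) c∈C = ∈-filter⁺ _ c∈C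
    (c≢q , Equivalence.from ∈-neighbours (Collinear-sym cq) ,
     All.map (λ ¬cqr → ¬cqr ∘ Collinear₃-swap ∘ Equivalence.to Any-linesThrough⇔Collinear₃) noLine)

  extendAll : ℕ → List V → List V → List (List V)
  extendAll zero qs C = [ qs ]
  extendAll (suc k) qs C = concatMap (λ q → extendAll k (q ∷ qs) (refine q qs C)) C

  extendAll-complete : ∀ ps {qs C} → (∀ {c} → Extends Lines c qs → c ∈ C) →
                       IsFreeClique Lines (ps ʳ++ qs) → ps ʳ++ qs ∈ extendAll (length ps) qs C
  extendAll-complete [] _ _ = here refl
  extendAll-complete (q ∷ ps) {qs} complete clique =
    ∈-concatMap⁺ (λ q → extendAll (length ps) (q ∷ qs) _)
      (lose (complete (proj₁ (IsFreeClique-suffix ps clique)))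
            (extendAll-complete ps (λ ext → ∈-refine ext (complete (Extends-tail ext))) clique))

  noCliqueThrough : ∀ k p → extendAll k [ p ] (neighbours p) ≡ [] → ¬ CliqueThrough k Lines p
  noCliqueThrough k p none (qs , refl , clique)
    with extendAll-complete (reverse qs) {C = neighbours p}
           (λ { ((_ , cp) ∷ [] , _) → Equivalence.from ∈-neighbours (Collinear-sym cp) })
           (subst (IsFreeClique Lines) (sym (reverse-ʳ++ qs [ p ])) clique)
  ... | found rewrite length-reverse qs | none = case found of λ ()

-- S and S' with their entries in normal form: written as e₅, e₁', … they would be re-evaluated at
-- every use inside the exhaustive checks below, which slows these down dramatically.
Sⁿ S'ⁿ : List V
Sⁿ = (o₃ ∷ o₃ ∷ o₃ ∷ o₃ ∷ []) ∷ (i₃ ∷ o₃ ∷ o₃ ∷ o₃ ∷ []) ∷ (o₃ ∷ i₃ ∷ o₃ ∷ o₃ ∷ [])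
   ∷ (o₃ ∷ o₃ ∷ i₃ ∷ o₃ ∷ []) ∷ (o₃ ∷ o₃ ∷ o₃ ∷ i₃ ∷ []) ∷ (-₃ i₃ ∷ -₃ i₃ ∷ -₃ i₃ ∷ -₃ i₃ ∷ []) ∷ []
S'ⁿ = (o₃ ∷ o₃ ∷ o₃ ∷ o₃ ∷ []) ∷ (-₃ i₃ ∷ o₃ ∷ i₃ ∷ o₃ ∷ []) ∷ (-₃ i₃ ∷ o₃ ∷ i₃ ∷ -₃ i₃ ∷ [])
    ∷ (o₃ ∷ -₃ i₃ ∷ o₃ ∷ i₃ ∷ []) ∷ (o₃ ∷ -₃ i₃ ∷ -₃ i₃ ∷ i₃ ∷ [])
    ∷ (-₃ i₃ ∷ -₃ i₃ ∷ -₃ i₃ ∷ -₃ i₃ ∷ []) ∷ []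

shapeOf : F₃ → List V
shapeOf (Fin.suc Fin.zero) = S'ⁿ
shapeOf _ = Sⁿ

module G = TranslationGeometry (λ _ → Sⁿ)
module G' = TranslationGeometry (shapeOf ∘ φ)

translation : V → Isomorphic 𝓛 𝓛
translation v = τ , image-line , preimage-line
  where
  τ : V ↔ V
  τ = mk↔ₛ′ (_⊕ v) (_⊖ v) (λ p → ⊖-⊕-cancelʳ p v) (λ p → ⊕-⊖-cancelʳ p v)
  image-line : ∀ ℓ → 𝓛 ℓ → 𝓛 (image τ ℓ)
  image-line ℓ (x , ℓ≈) = x ⊕ v , λ p → trans (ℓ≈ (p ⊖ v)) (+ₛ-translate x v S p)
  preimage-line : ∀ m → 𝓛 m → ∃[ ℓ ] (𝓛 ℓ × image τ ℓ ≈ₛ m)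
  preimage-line m (y , m≈) = (y ⊖ v) +ₛ S , (y ⊖ v , λ _ → refl) , λ p →
    trans (+ₛ-translate (y ⊖ v) v S p) (trans (cong (λ z → (z +ₛ S) p) (⊖-⊕-cancelʳ y v)) (sym (m≈ p)))

cliqueThrough𝟎-𝓛 : CliqueThrough 4 𝓛 𝟎
cliqueThrough𝟎-𝓛 = qs , refl , from-yes (G.isFreeClique? (qs ++ [ 𝟎 ]))
  where
  qs : List V
  qs = (i₃ ∷ i₃ ∷ i₃ ∷ -₃ i₃ ∷ []) ∷ (o₃ ∷ -₃ i₃ ∷ o₃ ∷ i₃ ∷ [])
     ∷ (o₃ ∷ o₃ ∷ -₃ i₃ ∷ i₃ ∷ []) ∷ (o₃ ∷ o₃ ∷ o₃ ∷ i₃ ∷ []) ∷ []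

cliqueThrough-𝓛 : ∀ p → CliqueThrough 4 𝓛 p
cliqueThrough-𝓛 p =
  subst (CliqueThrough 4 𝓛) (⊕-identityˡ p) (CliqueThrough-image (translation p) cliqueThrough𝟎-𝓛)

shapeOf-length : ∀ a → length (shapeOf a) ≡ 6
shapeOf-length = from-yes (Fin.all? λ a → length (shapeOf a) ℕ.≟ 6)

shapeOf-unique : ∀ a → Unique (shapeOf a)
shapeOf-unique = from-yes (Fin.all? λ a → AllPairs.allPairs? (λ u v → ¬? (u ≟V v)) (shapeOf a))

counts' : G'.IncidenceCounts 4 5 2
counts' = record
  { shape-length = shapeOf-length ∘ φ
  ; shape-unique = shapeOf-unique ∘ φ
  ; linesThrough-length = from-yes (∀V? λ p → length (G'.linesThrough p) ℕ.≟ 6)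
  ; meet-atMostOne = from-yes (∀V? λ x → ∀V? λ y →
                       ¬? (x ≟V y) →-dec (length (filter (G'._∈ₗ? y) (G'.pointsOn x)) ℕ.≤? 1))
  ; alpha-count = from-yes (∀V? λ p → G'.alpha-count-at? 2 (G'.neighbours p) p)
  }

shape-N₁ : ∀ {x} → InN₁ x → shapeOf (φ x) ≡ S'
shape-N₁ x∈N₁ = cong shapeOf (φ-coset e₃ x∈N₁)

shape-N₀₂ : ∀ {x} → InN₀ x ⊎ InN₂ x → shapeOf (φ x) ≡ S
shape-N₀₂ (inj₁ x∈N₀) = cong shapeOf (φ-N₀ x∈N₀)
shape-N₀₂ (inj₂ x∈N₂) = cong shapeOf (φ-coset (e₃ ⊕ e₄) x∈N₂)

G'-Lines⇔𝓛' : ∀ ℓ → G'.Lines ℓ ⇔ 𝓛' ℓ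
G'-Lines⇔𝓛' ℓ = mk⇔ to from
  where
  reshape : ∀ {x T T'} → ℓ ≈ₛ (x +ₛ T) → T ≡ T' → ℓ ≈ₛ (x +ₛ T')
  reshape ℓ≈ refl = ℓ≈
  to : G'.Lines ℓ → 𝓛' ℓ
  to (x , ℓ≈) = byCoset (N-cover x)
    -- deliberately not `with N-cover x`: abstracting over that exhaustive check exhausts memory
    where
    byCoset : InN₀ x ⊎ InN₁ x ⊎ InN₂ x → 𝓛' ℓ
    byCoset (inj₁ x∈N₀) = inj₂ (x , inj₁ x∈N₀ , reshape ℓ≈ (shape-N₀₂ (inj₁ x∈N₀)))
    byCoset (inj₂ (inj₁ x∈N₁)) = inj₁ (x , x∈N₁ , reshape ℓ≈ (shape-N₁ x∈N₁))
    byCoset (inj₂ (inj₂ x∈N₂)) = inj₂ (x , inj₂ x∈N₂ , reshape ℓ≈ (shape-N₀₂ (inj₂ x∈N₂)))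
  from : 𝓛' ℓ → G'.Lines ℓ
  from (inj₁ (x , x∈N₁ , ℓ≈)) = x , reshape ℓ≈ (sym (shape-N₁ x∈N₁))
  from (inj₂ (x , x∈N₀₂ , ℓ≈)) = x , reshape ℓ≈ (sym (shape-N₀₂ x∈N₀₂))

noCliqueThrough𝟎-G' : ¬ CliqueThrough 4 G'.Lines 𝟎
noCliqueThrough𝟎-G' = G'.noCliqueThrough 4 𝟎 refl

mainTheorem1 : IsPartialGeometry 5 5 2 𝓛' × ¬ Isomorphic 𝓛 𝓛'
mainTheorem1 = IsPartialGeometry-resp G'-Lines⇔𝓛' (G'.isPartialGeometry counts') , not-isomorphic
  where
  not-isomorphic : ¬ Isomorphic 𝓛 𝓛'
  not-isomorphic 𝓛≅𝓛' =
    noCliqueThrough𝟎-G' (CliqueThrough-everywhere 𝓛'≅G' (CliqueThrough-everywhere 𝓛≅𝓛' cliqueThrough-𝓛) 𝟎)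
    where
    𝓛'≅G' : Isomorphic 𝓛' G'.Lines
    𝓛'≅G' = Isomorphic-⇔ (⇔-sym ∘ G'-Lines⇔𝓛')
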